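{- Let $\mathbf{t}=01101001\cdots$ be the Thue–Morse word. Then $P(\mathbf{t}) = \frac{3}{10\ln2} \approx 0.4328$ and $p(\mathbf{t})=0$.
   Context: The Thue–Morse word $\mathbf{t}$ is the fixed point starting with $0$ of the morphism $\mu$ given by $\mu(0)=01$, $\mu(1)=10$. For a finite nonempty word $w$, an integer $p$ with $1\le p\le|w|$ is a period if $w[i]=w[i+p]$ for $1\le i\le |w|-p$; it is nontrivial if $p<|w|$; $\operatorname{nnp}(w)$ is the number of nontrivial periods; $\operatorname{per}(w)$ the least period; $\exp(w)=|w|/\operatorname{per}(w)$; $\operatorname{ice}(w)=\sup\{\exp(u): u \text{ a nonempty prefix of } w\}$. For a finite word $x$ with $|x|\ge2$ let $M(x)=\operatorname{nnp}(x)/(\operatorname{ice}(x)\ln|x|)$. For an infinite word $\mathbf{x}$ with length-$n$ prefix $Y_n$, define $P(\mathbf{x})=\limsup_{n\to\infty} M(Y_n)$ and $p(\mathbf{x})=\liminf_{n\to\infty} M(Y_n)$. -}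

module Defs where

open import Data.Bool using (Bool; true; false; not)
import Data.Bool as B
open import Data.Nat using (ℕ; zero; suc; _+_; _*_; _∸_; _^_; _≤_; _<_)
open import Data.List using (List; []; _∷_; length; take; drop; upTo; map; foldr; filterᵇ; findᵇ; concatMap)
open import Data.Maybe using (Maybe; just; nothing)
open import Data.Integer using (ℤ; +_; ∣_∣)
open import Data.Rational using (ℚ; _/_; _⊔_; ↥_; ↧ₙ_; 0ℚ)
open import Relation.Nullary.Decidable using (isYes)

-- Words over the alphabet {0,1}; the letter 0 is `false`, 1 is `true`.
Word : Set
Word = List Bool

μ : Word → Word
μ = concatMap (λ b → b ∷ not b ∷ [])

μ^ : ℕ → Word → Word
μ^ zero    w = w
μ^ (suc k) w = μ (μ^ k w)

-- Y n = length-n prefix of the Thue–Morse word t = lim μ^k(0).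
-- μ^n(0) has length 2^n ≥ n and is a prefix of t.
Y : ℕ → Word
Y n = take n (μ^ n (false ∷ []))

-- letter at 0-based position i (default irrelevant when i < |w|)
at : Word → ℕ → Bool
at []       i       = false
at (x ∷ w)  zero    = x
at (x ∷ w)  (suc i) = at w i

allᵇ : (ℕ → Bool) → List ℕ → Bool
allᵇ p = foldr (λ i b → p i B.∧ b) true

isPeriod : Word → ℕ → Bool
isPeriod w zero    = false
isPeriod w (suc k) =
  isYes (suc k Data.Nat.≤? length w) B.∧
  allᵇ (λ i → isYes (at w i B.≟ at w (i + suc k))) (upTo (length w ∸ suc k))

nnp : Word → ℕ
nnp w = length (filterᵇ (isPeriod w) (map suc (upTo (length w ∸ 1))))

-- least period; per w = suc (the least k with k+1 a period). |w| is always
-- a period of nonempty w, so the default is never used for nonempty w.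
perPred : Word → ℕ
perPred w with findᵇ (λ k → isPeriod w (suc k)) (upTo (length w))
... | just k  = k
... | nothing = length w ∸ 1

per : Word → ℕ
per w = suc (perPred w)

expo : Word → ℚ
expo w = (+ length w) / per w

iceFrom : Word → ℕ → ℚ
iceFrom w zero    = 0ℚ
iceFrom w (suc k) = iceFrom w k ⊔ expo (take (suc k) w)

ice : Word → ℚ
ice w = iceFrom w (length w)

-- For q ≥ 0 rational:  "2^m ≤ n^q"  encoded exactly as 2^(m·b) ≤ n^a, q = a/b.
2^≤^ : ℕ → ℕ → ℚ → Set
2^≤^ m n q = 2 ^ (m * ↧ₙ q) ≤ n ^ ∣ ↥ q ∣

^≤2^ : ℕ → ℕ → ℚ → Set
^≤2^ m n q = n ^ ∣ ↥ q ∣ ≤ 2 ^ (m * ↧ₙ q)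

-- For a word x with |x| = n ≥ 2 and rational c ≥ 0:
--   M(x) ≤ c / ln 2  ⇔  nnp(x)·ln 2 ≤ c·ice(x)·ln n  ⇔  2^nnp(x) ≤ n^(c·ice(x))
M≤/ln2 : Word → ℚ → Set
M≤/ln2 x c = 2^≤^ (nnp x) (length x) (c Data.Rational.* ice x)

--   M(x) ≥ c / ln 2  ⇔  n^(c·ice(x)) ≤ 2^nnp(x)
M≥/ln2 : Word → ℚ → Set
M≥/ln2 x c = ^≤2^ (nnp x) (length x) (c Data.Rational.* ice x)

-- The exponent of a prefix of t is at most 5/3: an even period 2p of t[0,n) halves to the
-- period p of t[0,⌈n/2⌉), and an odd period leaves an overlap of at most two letters, since
-- t 1 = t 2 while t (p+1) ≠ t (p+2). As 01101 has exponent 5/3, ice(Y n) = 5/3 for n ≥ 5.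
-- The same two facts give, for the number c(n) of nontrivial periods of Y n and n ≥ 1,
--   c(2n) = c(n) + t(n-1)   and   c(2n+1) = c(n+1) + t(n-1) t(n),
-- whence 4^c(n) ≤ 2n, while c(4^k + 1) = k and c(3·2^k + 1) = 1. Since
-- M(Y n) = 3 c(n) / (5 ln n), the limsup is 3/(10 ln 2) and the liminf is 0.
module Submission where

open import Defs

module ThueMorsePrefixes where

  open import Data.Bool using (Bool; true; false; not; _∧_; _xor_; T)
  open import Data.Bool.Properties using (T-∧; not-¬; ∧-zeroʳ; ∧-identityʳ)
  open import Data.Nat
    using (ℕ; zero; suc; pred; _+_; _*_; _∸_; _^_; _≤_; _<_; _⊓_; z≤n; s≤s; ⌊_/2⌋; ⌈_/2⌉; _≤?_;
           NonZero; >-nonZero)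
  open import Data.Nat.Properties
  open import Data.List using ([]; _∷_; length; take; upTo; applyUpTo; map; filterᵇ; findᵇ)
  open import Data.List.Properties using (length-take; map-applyUpTo)
  open import Data.List.Relation.Unary.All using (All; []; _∷_)
  open import Data.List.Relation.Unary.All.Properties using (applyUpTo⁺₁; applyUpTo⁻)
  import Data.Bool as Bool
  open import Data.Nat.Induction using (<-rec)
  open import Algebra.Properties.CommutativeSemigroup +-commutativeSemigroup using (xy∙z≈xz∙y)
  open import Algebra.Properties.CommutativeSemigroup *-commutativeSemigroup
    using () renaming (interchange to *-interchange)
  open import Data.Maybe using (just; nothing)
  open import Data.Maybe.Properties using (just-injective)
  open import Data.Sum using (_⊎_; inj₁; inj₂)
  open import Data.Integer as ℤ using (+_; -[1+_]; ∣_∣)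
  import Data.Integer.Properties as ℤ
  open import Data.Rational as ℚ using (ℚ; mkℚ; _/_; 0ℚ; ↥_; ↧ₙ_)
  import Data.Rational.Properties as ℚ
  import Data.Rational.Unnormalised as ℚᵘ
  import Data.Rational.Unnormalised.Properties as ℚᵘ
  open import Data.Product using (_×_; _,_; proj₂; ∃-syntax)
  open import Data.Empty using (⊥-elim)
  open import Function using (_∘_; id; _⇔_; mk⇔; Equivalence)
  open Equivalence using (to; from)
  open import Relation.Binary.PropositionalEquality
  open import Relation.Nullary using (yes; no)
  open import Relation.Nullary.Decidable using (isYes; toWitness; fromWitness)

  -- Doubling and halving

  dbl : ℕ → ℕ
  dbl zero    = zero
  dbl (suc n) = suc (suc (dbl n))

  data EvenOdd : ℕ → Set where
    even : ∀ r → EvenOdd (dbl r)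
    odd  : ∀ r → EvenOdd (suc (dbl r))

  evenOdd : ∀ n → EvenOdd n
  evenOdd zero = even zero
  evenOdd (suc n) with evenOdd n
  ... | even r = odd r
  ... | odd r  = even (suc r)

  dbl≡2* : ∀ n → dbl n ≡ 2 * n
  dbl≡2* zero    = refl
  dbl≡2* (suc n) = trans (cong (suc ∘ suc) (dbl≡2* n)) (cong suc (sym (+-suc n (n + 0))))

  n≤dbl : ∀ n → n ≤ dbl n
  n≤dbl zero    = z≤n
  n≤dbl (suc n) = s≤s (m≤n⇒m≤1+n (n≤dbl n))

  dbl-distrib-+ : ∀ m n → dbl (m + n) ≡ dbl m + dbl n
  dbl-distrib-+ zero    n = refl
  dbl-distrib-+ (suc m) n = cong (suc ∘ suc) (dbl-distrib-+ m n)

  dbl-mono-≤ : ∀ {m n} → m ≤ n → dbl m ≤ dbl n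
  dbl-mono-≤ z≤n       = z≤n
  dbl-mono-≤ (s≤s m≤n) = s≤s (s≤s (dbl-mono-≤ m≤n))

  dbl-cancel-≤ : ∀ {m n} → dbl m ≤ dbl n → m ≤ n
  dbl-cancel-≤ {zero}              _                 = z≤n
  dbl-cancel-≤ {suc m} {suc n} (s≤s (s≤s dm≤dn)) = s≤s (dbl-cancel-≤ dm≤dn)

  dbl-cancel-< : ∀ {m n} → dbl m < dbl n → m < n
  dbl-cancel-< {zero}  {suc n} _                 = s≤s z≤n
  dbl-cancel-< {suc m} {suc n} (s≤s (s≤s dm<dn)) = s≤s (dbl-cancel-< dm<dn)

  ⌊dbl/2⌋≡ : ∀ n → ⌊ dbl n /2⌋ ≡ n
  ⌊dbl/2⌋≡ zero    = refl
  ⌊dbl/2⌋≡ (suc n) = cong suc (⌊dbl/2⌋≡ n)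

  ⌊suc-dbl/2⌋≡ : ∀ n → ⌊ suc (dbl n) /2⌋ ≡ n
  ⌊suc-dbl/2⌋≡ zero    = refl
  ⌊suc-dbl/2⌋≡ (suc n) = cong suc (⌊suc-dbl/2⌋≡ n)

  dbl<⇔<⌈/2⌉ : ∀ m n → dbl m < n ⇔ m < ⌈ n /2⌉
  dbl<⇔<⌈/2⌉ m n = mk⇔ (halve m n) (double m n)
    where
    halve : ∀ m n → dbl m < n → m < ⌈ n /2⌉
    halve zero    (suc n)       _                 = s≤s z≤n
    halve (suc m) (suc (suc n)) (s≤s (s≤s dm<n)) = s≤s (halve m n dm<n)
    double : ∀ m n → m < ⌈ n /2⌉ → dbl m < n
    double zero    (suc n)       _            = s≤s z≤n
    double (suc m) (suc (suc n)) (s≤s m<⌈n/2⌉) = s≤s (s≤s (double m n m<⌈n/2⌉))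

  n≤dbl⌈n/2⌉ : ∀ n → n ≤ dbl ⌈ n /2⌉
  n≤dbl⌈n/2⌉ zero          = z≤n
  n≤dbl⌈n/2⌉ (suc zero)    = s≤s z≤n
  n≤dbl⌈n/2⌉ (suc (suc n)) = s≤s (s≤s (n≤dbl⌈n/2⌉ n))

  -- The Thue–Morse word and its prefixes

  oddᵇ : ℕ → Bool
  oddᵇ zero          = false
  oddᵇ (suc zero)    = true
  oddᵇ (suc (suc n)) = oddᵇ n

  oddᵇ-dbl : ∀ n → oddᵇ (dbl n) ≡ false
  oddᵇ-dbl zero    = refl
  oddᵇ-dbl (suc n) = oddᵇ-dbl n

  oddᵇ-suc-dbl : ∀ n → oddᵇ (suc (dbl n)) ≡ true
  oddᵇ-suc-dbl zero    = refl
  oddᵇ-suc-dbl (suc n) = oddᵇ-suc-dbl n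

  oddᵇ-suc : ∀ n → oddᵇ (suc n) ≡ not (oddᵇ n)
  oddᵇ-suc zero          = refl
  oddᵇ-suc (suc zero)    = refl
  oddᵇ-suc (suc (suc n)) = oddᵇ-suc n

  -- t n is the parity of the binary digit sum of n; every fuel f ≥ n gives that value.
  tmFuel : ℕ → ℕ → Bool
  tmFuel zero    n = false
  tmFuel (suc f) n = oddᵇ n xor tmFuel f ⌊ n /2⌋

  tm : ℕ → Bool
  tm n = tmFuel n n

  tmFuel-stable : ∀ f g n → n ≤ f → n ≤ g → tmFuel f n ≡ tmFuel g n
  tmFuel-stable zero    zero    zero _ _ = refl
  tmFuel-stable zero    (suc g) zero _ _ = tmFuel-stable zero g zero z≤n z≤n
  tmFuel-stable (suc f) zero    zero _ _ = tmFuel-stable f zero zero z≤n z≤n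
  tmFuel-stable (suc f) (suc g) n n≤f n≤g =
    cong (oddᵇ n xor_) (tmFuel-stable f g ⌊ n /2⌋ (halve n≤f) (halve n≤g))
    where
    halve : ∀ {n f} → n ≤ suc f → ⌊ n /2⌋ ≤ f
    halve {f = f} n≤f = ≤-trans (⌊n/2⌋-mono n≤f) (≤-pred (⌊n/2⌋<n f))

  tm-dbl : ∀ n → tm (dbl n) ≡ tm n
  tm-dbl zero    = refl
  tm-dbl (suc n) = begin
    tmFuel (suc (suc (dbl n))) (dbl (suc n))
      ≡⟨ cong₂ _xor_ (oddᵇ-dbl (suc n)) (cong (tmFuel (suc (dbl n))) (⌊dbl/2⌋≡ (suc n))) ⟩
    tmFuel (suc (dbl n)) (suc n)
      ≡⟨ tmFuel-stable (suc (dbl n)) (suc n) (suc n) (s≤s (n≤dbl n)) ≤-refl ⟩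
    tm (suc n) ∎
    where open ≡-Reasoning

  tm-suc-dbl : ∀ n → tm (suc (dbl n)) ≡ not (tm n)
  tm-suc-dbl n = begin
    tmFuel (suc (dbl n)) (suc (dbl n))
      ≡⟨ cong₂ _xor_ (oddᵇ-suc-dbl n) (cong (tmFuel (dbl n)) (⌊suc-dbl/2⌋≡ n)) ⟩
    not (tmFuel (dbl n) n)
      ≡⟨ cong not (tmFuel-stable (dbl n) n n (n≤dbl n) ≤-refl) ⟩
    not (tm n) ∎
    where open ≡-Reasoning

  _·2^_ : ℕ → ℕ → ℕ
  m ·2^ zero  = m
  m ·2^ suc k = dbl (m ·2^ k)

  tm-·2^ : ∀ m k → tm (m ·2^ k) ≡ tm m
  tm-·2^ m zero    = refl
  tm-·2^ m (suc k) = trans (tm-dbl (m ·2^ k)) (tm-·2^ m k)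

  n<1·2^n : ∀ n → n < 1 ·2^ n
  n<1·2^n zero    = s≤s z≤n
  n<1·2^n (suc n) with 1 ·2^ n | n<1·2^n n
  ... | suc x | n<1+x = s≤s (≤-trans n<1+x (s≤s (n≤dbl x)))

  m≤m·2^k : ∀ m k → m ≤ m ·2^ k
  m≤m·2^k m zero    = ≤-refl
  m≤m·2^k m (suc k) = ≤-trans (m≤m·2^k m k) (n≤dbl (m ·2^ k))

  1·2^≡2^ : ∀ k → 1 ·2^ k ≡ 2 ^ k
  1·2^≡2^ zero    = refl
  1·2^≡2^ (suc k) = trans (dbl≡2* (1 ·2^ k)) (cong (2 *_) (1·2^≡2^ k))

  ·2^-monoˡ-≤ : ∀ {m n} k → m ≤ n → m ·2^ k ≤ n ·2^ k
  ·2^-monoˡ-≤ zero    m≤n = m≤n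
  ·2^-monoˡ-≤ (suc k) m≤n = dbl-mono-≤ (·2^-monoˡ-≤ k m≤n)

  IsPrefixᵗ : Word → Set
  IsPrefixᵗ u = ∀ i → i < length u → at u i ≡ tm i

  length-μ : ∀ w → length (μ w) ≡ dbl (length w)
  length-μ []      = refl
  length-μ (b ∷ w) = cong (suc ∘ suc) (length-μ w)

  at-μ-dbl : ∀ w i → i < length w → at (μ w) (dbl i) ≡ at w i
  at-μ-dbl (b ∷ w) zero    _         = refl
  at-μ-dbl (b ∷ w) (suc i) (s≤s i<w) = at-μ-dbl w i i<w

  at-μ-suc-dbl : ∀ w i → i < length w → at (μ w) (suc (dbl i)) ≡ not (at w i)
  at-μ-suc-dbl (b ∷ w) zero    _         = refl
  at-μ-suc-dbl (b ∷ w) (suc i) (s≤s i<w) = at-μ-suc-dbl w i i<w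

  μ-prefix : ∀ u → IsPrefixᵗ u → IsPrefixᵗ (μ u)
  μ-prefix u pre i i<μu with evenOdd i
  ... | even r = begin
    at (μ u) (dbl r) ≡⟨ at-μ-dbl u r r<u ⟩
    at u r           ≡⟨ pre r r<u ⟩
    tm r             ≡⟨ tm-dbl r ⟨
    tm (dbl r)       ∎
    where
    open ≡-Reasoning
    r<u : r < length u
    r<u = dbl-cancel-< (subst (dbl r <_) (length-μ u) i<μu)
  ... | odd r = begin
    at (μ u) (suc (dbl r)) ≡⟨ at-μ-suc-dbl u r r<u ⟩
    not (at u r)           ≡⟨ cong not (pre r r<u) ⟩
    not (tm r)             ≡⟨ tm-suc-dbl r ⟨
    tm (suc (dbl r))       ∎
    where
    open ≡-Reasoning
    r<u : r < length u
    r<u = dbl-cancel-≤ (subst (suc (dbl r) <_) (length-μ u) i<μu)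

  μ^-prefix : ∀ k → IsPrefixᵗ (μ^ k (false ∷ []))
  μ^-prefix zero    zero    _           = refl
  μ^-prefix zero    (suc i) (s≤s ())
  μ^-prefix (suc k) = μ-prefix (μ^ k (false ∷ [])) (μ^-prefix k)

  length-μ^ : ∀ k w → length (μ^ k w) ≡ length w ·2^ k
  length-μ^ zero    w = refl
  length-μ^ (suc k) w = trans (length-μ (μ^ k w)) (cong dbl (length-μ^ k w))

  at-take : ∀ k w i → i < k → at (take k w) i ≡ at w i
  at-take (suc k) []      i       _         = refl
  at-take (suc k) (b ∷ w) zero    _         = refl
  at-take (suc k) (b ∷ w) (suc i) (s≤s i<k) = at-take k w i i<k

  take-prefix : ∀ k u → IsPrefixᵗ u → IsPrefixᵗ (take k u)
  take-prefix k u pre i i<ku = trans (at-take k u i (m<n⊓o⇒m<n k (length u) i<k⊓u))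
                                       (pre i (m<n⊓o⇒m<o k (length u) i<k⊓u))
    where
    i<k⊓u : i < k ⊓ length u
    i<k⊓u = subst (i <_) (length-take k u) i<ku

  length-Y : ∀ n → length (Y n) ≡ n
  length-Y n = begin
    length (Y n)                           ≡⟨ length-take n (μ^ n (false ∷ [])) ⟩
    n ⊓ length (μ^ n (false ∷ []))         ≡⟨ cong (n ⊓_) (length-μ^ n (false ∷ [])) ⟩
    n ⊓ 1 ·2^ n                            ≡⟨ m≤n⇒m⊓n≡m (<⇒≤ (n<1·2^n n)) ⟩
    n                                      ∎
    where open ≡-Reasoning

  Y-prefix : ∀ n → IsPrefixᵗ (Y n)
  Y-prefix n = take-prefix n (μ^ n (false ∷ [])) (μ^-prefix n)

  -- Periods of prefixes

  T-injective : ∀ {a b} → (T a → T b) → (T b → T a) → a ≡ b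
  T-injective {false} {false} _ _ = refl
  T-injective {false} {true}  _ g = ⊥-elim (g _)
  T-injective {true}  {false} f _ = ⊥-elim (f _)
  T-injective {true}  {true}  _ _ = refl

  T-allᵇ : ∀ f xs → T (allᵇ f xs) ⇔ All (T ∘ f) xs
  T-allᵇ f []       = mk⇔ (λ _ → []) (λ _ → _)
  T-allᵇ f (x ∷ xs) = mk⇔
    (λ fx∧fxs → let fx , fxs = to T-∧ fx∧fxs in fx ∷ to (T-allᵇ f xs) fxs)
    (λ { (fx ∷ fxs) → from T-∧ (fx , from (T-allᵇ f xs) fxs) })

  HasPeriod : (ℕ → Bool) → ℕ → ℕ → Set
  HasPeriod x n p = ∀ i → i + p < n → x i ≡ x (i + p)

  -- isPeriod w p computes to isPeriodOf (at w) (length w) p.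
  isPeriodOf : (ℕ → Bool) → ℕ → ℕ → Bool
  isPeriodOf x n zero    = false
  isPeriodOf x n (suc k) =
    isYes (suc k ≤? n) ∧ allᵇ (λ i → isYes (x i Bool.≟ x (i + suc k))) (upTo (n ∸ suc k))

  isPeriodᵗ : ℕ → ℕ → Bool
  isPeriodᵗ = isPeriodOf tm

  T-isPeriodOf : ∀ x n k → T (isPeriodOf x n (suc k)) ⇔ (suc k ≤ n × HasPeriod x n (suc k))
  T-isPeriodOf x n k = mk⇔
    (λ t → let p≤n , agree = to (T-∧ {isYes (suc k ≤? n)}) t in
      toWitness p≤n , λ i i+p<n →
        toWitness (applyUpTo⁻ id (n ∸ suc k) (to (T-allᵇ agrees _) agree)
                               (m+n≤o⇒m≤o∸n (suc i) i+p<n)))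
    (λ { (p≤n , per) → from T-∧ (fromWitness p≤n , from (T-allᵇ agrees _)
      (applyUpTo⁺₁ id (n ∸ suc k) λ {i} i<n∸p →
        fromWitness (per i (m≤o∸n⇒m+n≤o (suc i) p≤n i<n∸p)))) })
    where
    agrees : ℕ → Bool
    agrees i = isYes (x i Bool.≟ x (i + suc k))

  isPeriodOf-≡ : ∀ {x y n m k l} → (suc k ≤ n ⇔ suc l ≤ m) →
                 (HasPeriod x n (suc k) ⇔ HasPeriod y m (suc l)) →
                 isPeriodOf x n (suc k) ≡ isPeriodOf y m (suc l)
  isPeriodOf-≡ {x} {y} {n} {m} {k} {l} ≤⇔ per⇔ = T-injective
    (λ t → let p≤n , per = to (T-isPeriodOf x n k) t in
      from (T-isPeriodOf y m l) (to ≤⇔ p≤n , to per⇔ per))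
    (λ t → let p≤m , per = to (T-isPeriodOf y m l) t in
      from (T-isPeriodOf x n k) (from ≤⇔ p≤m , from per⇔ per))

  isPeriod-prefix : ∀ u p → IsPrefixᵗ u → isPeriod u p ≡ isPeriodᵗ (length u) p
  isPeriod-prefix u zero    _   = refl
  isPeriod-prefix u (suc k) pre = isPeriodOf-≡ (mk⇔ id id) (mk⇔
    (λ per i i+p<u → trans (sym (pre i (i<u i i+p<u))) (trans (per i i+p<u) (pre (i + suc k) i+p<u)))
    (λ per i i+p<u → trans (pre i (i<u i i+p<u)) (trans (per i i+p<u) (sym (pre (i + suc k) i+p<u)))))
    where
    i<u : ∀ i → i + suc k < length u → i < length u
    i<u i = ≤-trans (s≤s (m≤m+n i (suc k)))

  HasPeriod-dbl : ∀ n p → HasPeriod tm n (dbl p) ⇔ HasPeriod tm ⌈ n /2⌉ p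
  HasPeriod-dbl n p = mk⇔ halve double
    where
    open ≡-Reasoning
    halve : HasPeriod tm n (dbl p) → HasPeriod tm ⌈ n /2⌉ p
    halve per i i+p<⌈n/2⌉ = begin
      tm i               ≡⟨ tm-dbl i ⟨
      tm (dbl i)         ≡⟨ per (dbl i) (subst (_< n) (dbl-distrib-+ i p) 2[i+p]<n) ⟩
      tm (dbl i + dbl p) ≡⟨ cong tm (dbl-distrib-+ i p) ⟨
      tm (dbl (i + p))   ≡⟨ tm-dbl (i + p) ⟩
      tm (i + p)         ∎
      where
      2[i+p]<n : dbl (i + p) < n
      2[i+p]<n = from (dbl<⇔<⌈/2⌉ (i + p) n) i+p<⌈n/2⌉
    double : HasPeriod tm ⌈ n /2⌉ p → HasPeriod tm n (dbl p)
    double per j j+2p<n with evenOdd j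
    ... | even i = begin
      tm (dbl i)         ≡⟨ tm-dbl i ⟩
      tm i               ≡⟨ per i (to (dbl<⇔<⌈/2⌉ (i + p) n) 2[i+p]<n) ⟩
      tm (i + p)         ≡⟨ tm-dbl (i + p) ⟨
      tm (dbl (i + p))   ≡⟨ cong tm (dbl-distrib-+ i p) ⟩
      tm (dbl i + dbl p) ∎
      where
      2[i+p]<n : dbl (i + p) < n
      2[i+p]<n = subst (_< n) (sym (dbl-distrib-+ i p)) j+2p<n
    ... | odd i = begin
      tm (suc (dbl i))         ≡⟨ tm-suc-dbl i ⟩
      not (tm i)               ≡⟨ cong not (per i (to (dbl<⇔<⌈/2⌉ (i + p) n) 2[i+p]<n)) ⟩
      not (tm (i + p))         ≡⟨ tm-suc-dbl (i + p) ⟨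
      tm (suc (dbl (i + p)))   ≡⟨ cong (tm ∘ suc) (dbl-distrib-+ i p) ⟩
      tm (suc (dbl i + dbl p)) ∎
      where
      2[i+p]<n : dbl (i + p) < n
      2[i+p]<n = <-trans (n<1+n _) (subst (λ m → suc m < n) (sym (dbl-distrib-+ i p)) j+2p<n)

  HasPeriod-1 : ∀ {n} → HasPeriod tm n 1 → n ≤ 1
  HasPeriod-1 {n} per with n ≤? 1
  ... | yes n≤1 = n≤1
  ... | no  n≰1 with per 0 (≰⇒> n≰1)
  ...   | ()

  HasPeriod-odd : ∀ {n} q → HasPeriod tm n (suc (dbl q)) → n ≤ 3 + dbl q
  HasPeriod-odd {n} q per with n ≤? 3 + dbl q
  ... | yes n≤p+2 = n≤p+2
  ... | no  n≰p+2 = ⊥-elim (not-¬ refl (trans (sym t₁) t₂))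
    where
    p+2<n : 2 + suc (dbl q) < n
    p+2<n = ≰⇒> n≰p+2
    t₁ : true ≡ tm (suc q)
    t₁ = trans (per 1 (<-trans (n<1+n _) p+2<n)) (tm-dbl (suc q))
    t₂ : true ≡ not (tm (suc q))
    t₂ = trans (per 2 p+2<n) (tm-suc-dbl (suc q))

  *-dbl : ∀ m n → m * dbl n ≡ dbl (m * n)
  *-dbl m n = begin
    m * dbl n     ≡⟨ cong (m *_) (dbl≡2* n) ⟩
    m * (2 * n)   ≡⟨ *-assoc m 2 n ⟨
    m * 2 * n     ≡⟨ cong (_* n) (*-comm m 2) ⟩
    2 * m * n     ≡⟨ *-assoc 2 m n ⟩
    2 * (m * n)   ≡⟨ dbl≡2* (m * n) ⟨
    dbl (m * n)   ∎
    where open ≡-Reasoning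

  3*[2+p]≤5*p : ∀ {p} → 3 ≤ p → 3 * (2 + p) ≤ 5 * p
  3*[2+p]≤5*p {p} 3≤p = begin
    3 * (2 + p)   ≡⟨ *-distribˡ-+ 3 2 p ⟩
    6 + 3 * p     ≤⟨ +-monoˡ-≤ (3 * p) (*-monoʳ-≤ 2 3≤p) ⟩
    2 * p + 3 * p ≡⟨ *-distribʳ-+ p 2 3 ⟨
    5 * p         ∎
    where open ≤-Reasoning

  HasPeriod-ratio : ∀ p {n} → 0 < p → HasPeriod tm n p → 3 * n ≤ 5 * p
  HasPeriod-ratio = <-rec (λ p → ∀ {n} → 0 < p → HasPeriod tm n p → 3 * n ≤ 5 * p) ratio
    where
    ratio : ∀ p → (∀ {q} → q < p → ∀ {n} → 0 < q → HasPeriod tm n q → 3 * n ≤ 5 * q) →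
            ∀ {n} → 0 < p → HasPeriod tm n p → 3 * n ≤ 5 * p
    ratio p rec {n} 0<p per with evenOdd p
    ... | even zero    = ⊥-elim (<-irrefl refl 0<p)
    ... | even (suc q) = begin
      3 * n             ≤⟨ *-monoʳ-≤ 3 (n≤dbl⌈n/2⌉ n) ⟩
      3 * dbl ⌈ n /2⌉   ≡⟨ *-dbl 3 ⌈ n /2⌉ ⟩
      dbl (3 * ⌈ n /2⌉) ≤⟨ dbl-mono-≤ (rec (s≤s (s≤s (n≤dbl q))) (s≤s z≤n) half-period) ⟩
      dbl (5 * suc q)   ≡⟨ *-dbl 5 (suc q) ⟨
      5 * dbl (suc q)   ∎
      where
      open ≤-Reasoning
      half-period : HasPeriod tm ⌈ n /2⌉ (suc q)
      half-period = to (HasPeriod-dbl n (suc q)) per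
    ... | odd zero     = ≤-trans (*-monoʳ-≤ 3 (HasPeriod-1 per)) (s≤s (s≤s (s≤s z≤n)))
    ... | odd (suc q)  =
      ≤-trans (*-monoʳ-≤ 3 (HasPeriod-odd (suc q) per)) (3*[2+p]≤5*p (s≤s (s≤s (s≤s z≤n))))

  -- The initial critical exponent

  findᵇ-sound : ∀ (P : ℕ → Bool) xs {k} → findᵇ P xs ≡ just k → T (P k)
  findᵇ-sound P (x ∷ xs) eq with P x in Px
  ... | true  = subst (T ∘ P) (just-injective eq) (subst T (sym Px) _)
  ... | false = findᵇ-sound P xs eq

  per-period : ∀ u → T (isPeriod u (per u)) ⊎ length u ≤ per u
  per-period u with findᵇ (λ k → isPeriod u (suc k)) (upTo (length u)) in found
  ... | just k  = inj₁ (findᵇ-sound (λ k → isPeriod u (suc k)) (upTo (length u)) found)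
  ... | nothing = inj₂ (m≤n+m∸n (length u) 1)

  per-ratio : ∀ u → IsPrefixᵗ u → 3 * length u ≤ 5 * per u
  per-ratio u pre with per-period u
  ... | inj₁ period = HasPeriod-ratio (per u) {length u} (s≤s z≤n)
    (proj₂ (to (T-isPeriodOf tm (length u) (perPred u)) (subst T (isPeriod-prefix u (per u) pre) period)))
  ... | inj₂ u≤per  = ≤-trans (*-monoʳ-≤ 3 u≤per) (*-monoˡ-≤ (per u) {3} {5} (s≤s (s≤s (s≤s z≤n))))

  +a/b≤+c/d : ∀ a b c d → a * suc d ≤ c * suc b → + a / suc b ℚ.≤ + c / suc d
  +a/b≤+c/d a b c d ad≤cb = ℚ.toℚᵘ-cancel-≤
    (ℚᵘ.≤-respˡ-≃ (ℚᵘ.≃-sym (ℚ.toℚᵘ-fromℚᵘ (ℚᵘ.mkℚᵘ (+ a) b)))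
    (ℚᵘ.≤-respʳ-≃ (ℚᵘ.≃-sym (ℚ.toℚᵘ-fromℚᵘ (ℚᵘ.mkℚᵘ (+ c) d)))
      (ℚᵘ.*≤* (subst₂ ℤ._≤_ (ℤ.pos-* a (suc d)) (ℤ.pos-* c (suc b)) (ℤ.+≤+ ad≤cb)))))

  5/3 : ℚ
  5/3 = + 5 / 3

  expo-prefix : ∀ u → IsPrefixᵗ u → expo u ℚ.≤ 5/3
  expo-prefix u pre =
    +a/b≤+c/d (length u) (perPred u) 5 2 (subst (_≤ 5 * per u) (*-comm 3 (length u)) (per-ratio u pre))

  ice-prefix : ∀ u → IsPrefixᵗ u → ice u ℚ.≤ 5/3
  ice-prefix u pre = bound (length u)
    where
    bound : ∀ k → iceFrom u k ℚ.≤ 5/3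
    bound zero    = ℚ.nonNegative⁻¹ 5/3
    bound (suc k) = ℚ.⊔-lub (bound k) (expo-prefix (take (suc k) u) (take-prefix (suc k) u pre))

  iceFrom-mono : ∀ u k j → iceFrom u k ℚ.≤ iceFrom u (j + k)
  iceFrom-mono u k zero    = ℚ.≤-refl
  iceFrom-mono u k (suc j) =
    ℚ.≤-trans (iceFrom-mono u k j) (ℚ.p≤p⊔q (iceFrom u (j + k)) (expo (take (suc (j + k)) u)))

  at-injective : ∀ {u v} → length u ≡ length v → (∀ i → i < length u → at u i ≡ at v i) → u ≡ v
  at-injective {[]}    {[]}    _   _    = refl
  at-injective {a ∷ u} {b ∷ v} len same =
    cong₂ _∷_ (same 0 (s≤s z≤n)) (at-injective (suc-injective len) (λ i i<u → same (suc i) (s≤s i<u)))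

  prefix-unique : ∀ u v → IsPrefixᵗ u → IsPrefixᵗ v → length u ≡ length v → u ≡ v
  prefix-unique u v pre-u pre-v len = at-injective len
    (λ i i<u → trans (pre-u i i<u) (sym (pre-v i (subst (i <_) len i<u))))

  -- The first step is the computation expo 01101 = 5/3.
  ice-Y : ∀ {n} → 5 ≤ n → ice (Y n) ≡ 5/3
  ice-Y {n} 5≤n = ℚ.≤-antisym (ice-prefix (Y n) (Y-prefix n)) (begin
    5/3                       ≡⟨ cong expo Y₅≡ ⟨
    expo (take 5 (Y n))       ≤⟨ ℚ.p≤q⊔p (iceFrom (Y n) 4) (expo (take 5 (Y n))) ⟩
    iceFrom (Y n) 5           ≤⟨ iceFrom-mono (Y n) 5 (L ∸ 5) ⟩
    iceFrom (Y n) (L ∸ 5 + 5) ≡⟨ cong (iceFrom (Y n)) (m∸n+n≡m 5≤L) ⟩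
    ice (Y n)                 ∎)
    where
    open ℚ.≤-Reasoning
    L = length (Y n)
    5≤L : 5 ≤ L
    5≤L = subst (5 ≤_) (sym (length-Y n)) 5≤n
    Y₅≡ : take 5 (Y n) ≡ Y 5
    Y₅≡ = prefix-unique (take 5 (Y n)) (Y 5) (take-prefix 5 (Y n) (Y-prefix n)) (Y-prefix 5)
      (trans (length-take 5 (Y n)) (trans (cong (5 ⊓_) (length-Y n)) (m≤n⇒m⊓n≡m 5≤n)))

  -- Counting periods

  fromBool : Bool → ℕ
  fromBool false = 0
  fromBool true  = 1

  count : (ℕ → Bool) → ℕ → ℕ
  count P zero    = 0
  count P (suc n) = count P n + fromBool (P n)

  count-cong : ∀ {P Q} n → (∀ i → i < n → P i ≡ Q i) → count P n ≡ count Q n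
  count-cong zero    _  = refl
  count-cong (suc n) P≡Q =
    cong₂ _+_ (count-cong n (λ i i<n → P≡Q i (m<n⇒m<1+n i<n))) (cong fromBool (P≡Q n ≤-refl))

  count-false : ∀ {P} n → (∀ i → i < n → P i ≡ false) → count P n ≡ 0
  count-false zero    _        = refl
  count-false (suc n) P≡false =
    cong₂ _+_ (count-false n (λ i i<n → P≡false i (m<n⇒m<1+n i<n))) (cong fromBool (P≡false n ≤-refl))

  count-suc : ∀ P n → count P (suc n) ≡ fromBool (P 0) + count (P ∘ suc) n
  count-suc P zero    = +-comm 0 (fromBool (P 0))
  count-suc P (suc n) = trans (cong (_+ fromBool (P (suc n))) (count-suc P n))
                              (+-assoc (fromBool (P 0)) (count (P ∘ suc) n) (fromBool (P (suc n))))

  length-filterᵇ : ∀ (P : ℕ → Bool) f n → length (filterᵇ P (applyUpTo f n)) ≡ count (P ∘ f) n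
  length-filterᵇ P f zero    = refl
  length-filterᵇ P f (suc n) = begin
    length (filterᵇ P (f 0 ∷ applyUpTo (f ∘ suc) n))
      ≡⟨ length-filterᵇ-∷ (f 0) (applyUpTo (f ∘ suc) n) ⟩
    fromBool (P (f 0)) + length (filterᵇ P (applyUpTo (f ∘ suc) n))
      ≡⟨ cong (_+_ (fromBool (P (f 0)))) (length-filterᵇ P (f ∘ suc) n) ⟩
    fromBool (P (f 0)) + count (P ∘ f ∘ suc) n
      ≡⟨ count-suc (P ∘ f) n ⟨
    count (P ∘ f) (suc n) ∎
    where
    open ≡-Reasoning
    length-filterᵇ-∷ : ∀ x xs → length (filterᵇ P (x ∷ xs)) ≡ fromBool (P x) + length (filterᵇ P xs)
    length-filterᵇ-∷ x xs with P x
    ... | true  = refl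
    ... | false = refl

  count-dbl : ∀ P n → count P (dbl n) ≡ count (P ∘ dbl) n + count (P ∘ suc ∘ dbl) n
  count-dbl P zero    = refl
  count-dbl P (suc n) = begin
    count P (dbl n) + fromBool (P (dbl n)) + fromBool (P (suc (dbl n)))
      ≡⟨ cong (λ c → c + fromBool (P (dbl n)) + fromBool (P (suc (dbl n)))) (count-dbl P n) ⟩
    evens + odds + fromBool (P (dbl n)) + fromBool (P (suc (dbl n)))
      ≡⟨ cong (_+ fromBool (P (suc (dbl n)))) (xy∙z≈xz∙y evens odds (fromBool (P (dbl n)))) ⟩
    evens + fromBool (P (dbl n)) + odds + fromBool (P (suc (dbl n)))
      ≡⟨ +-assoc (evens + fromBool (P (dbl n))) odds (fromBool (P (suc (dbl n)))) ⟩
    count (P ∘ dbl) (suc n) + count (P ∘ suc ∘ dbl) (suc n) ∎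
    where
    open ≡-Reasoning
    evens = count (P ∘ dbl) n
    odds  = count (P ∘ suc ∘ dbl) n

  count-halves : ∀ P n → count P n ≡ count (P ∘ dbl) ⌈ n /2⌉ + count (P ∘ suc ∘ dbl) ⌊ n /2⌋
  count-halves P n with evenOdd n
  ... | even m rewrite ⌊suc-dbl/2⌋≡ m | ⌊dbl/2⌋≡ m = count-dbl P m
  ... | odd m rewrite ⌊suc-dbl/2⌋≡ m | ⌊dbl/2⌋≡ m =
    trans (cong (_+ fromBool (P (dbl m))) (count-dbl P m))
          (xy∙z≈xz∙y (count (P ∘ dbl) m) (count (P ∘ suc ∘ dbl) m) (fromBool (P (dbl m))))

  periodCount : ℕ → ℕ
  periodCount n = count (isPeriodᵗ n) n

  nnp-prefix : ∀ u → IsPrefixᵗ u → nnp u ≡ periodCount (length u)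
  nnp-prefix u pre = begin
    length (filterᵇ (isPeriod u) (map suc (upTo (L ∸ 1))))
      ≡⟨ cong (length ∘ filterᵇ (isPeriod u)) (map-applyUpTo id suc (L ∸ 1)) ⟩
    length (filterᵇ (isPeriod u) (applyUpTo suc (L ∸ 1)))
      ≡⟨ length-filterᵇ (isPeriod u) suc (L ∸ 1) ⟩
    count (isPeriod u ∘ suc) (L ∸ 1)
      ≡⟨ count-cong (L ∸ 1) (λ i _ → isPeriod-prefix u (suc i) pre) ⟩
    count (isPeriodᵗ L ∘ suc) (L ∸ 1)
      ≡⟨ shift L ⟩
    periodCount L ∎
    where
    open ≡-Reasoning
    L = length u
    shift : ∀ L → count (isPeriodᵗ L ∘ suc) (L ∸ 1) ≡ periodCount L
    shift zero    = refl
    shift (suc L) = sym (count-suc (isPeriodᵗ (suc L)) L)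

  nnp-Y : ∀ n → nnp (Y n) ≡ periodCount n
  nnp-Y n = trans (nnp-prefix (Y n) (Y-prefix n)) (cong periodCount (length-Y n))

  isPeriodᵗ-dbl : ∀ {n} q → q < ⌈ n /2⌉ → isPeriodᵗ n (dbl q) ≡ isPeriodᵗ ⌈ n /2⌉ q
  isPeriodᵗ-dbl         zero    _         = refl
  isPeriodᵗ-dbl {n} (suc k) q<⌈n/2⌉ = isPeriodOf-≡
    (mk⇔ (λ _ → <⇒≤ q<⌈n/2⌉) (λ _ → <⇒≤ (from (dbl<⇔<⌈/2⌉ (suc k) n) q<⌈n/2⌉)))
    (HasPeriod-dbl n (suc k))

  isPeriodᵗ-odd : ∀ {n} q → 3 + dbl q < n → isPeriodᵗ n (suc (dbl q)) ≡ false
  isPeriodᵗ-odd {n} q p+3≤n = T-injective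
    (λ t → <⇒≱ p+3≤n (HasPeriod-odd q (proj₂ (to (T-isPeriodOf tm n (dbl q)) t))))
    (λ ())

  count-odd-periods : ∀ {n} r → dbl (suc r) ≤ n →
                      count (isPeriodᵗ n ∘ suc ∘ dbl) (suc r) ≡ fromBool (isPeriodᵗ n (suc (dbl r)))
  count-odd-periods {n} r 2r+2≤n = cong (_+ fromBool (isPeriodᵗ n (suc (dbl r))))
    (count-false r (λ q q<r → isPeriodᵗ-odd q (≤-trans (dbl-mono-≤ (s≤s q<r)) 2r+2≤n)))

  periodCount-halves : ∀ n →
    periodCount n ≡ periodCount ⌈ n /2⌉ + count (isPeriodᵗ n ∘ suc ∘ dbl) ⌊ n /2⌋
  periodCount-halves n = trans (count-halves (isPeriodᵗ n) n)
    (cong (_+ count (isPeriodᵗ n ∘ suc ∘ dbl) ⌊ n /2⌋) (count-cong ⌈ n /2⌉ (λ q → isPeriodᵗ-dbl q)))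

  isPeriodᵗ-overlap : ∀ m k →
    isPeriodᵗ (m + suc k) (suc k) ≡ allᵇ (λ i → isYes (tm i Bool.≟ tm (i + suc k))) (upTo m)
  isPeriodᵗ-overlap m k = cong₂ _∧_
    (T-injective (λ _ → _) (λ _ → fromWitness (m≤n+m (suc k) m)))
    (cong (λ m → allᵇ (λ i → isYes (tm i Bool.≟ tm (i + suc k))) (upTo m)) (m+n∸n≡m m (suc k)))

  periodCount-dbl : ∀ {n} → 1 ≤ n → periodCount (dbl n) ≡ periodCount n + fromBool (tm (pred n))
  periodCount-dbl {suc r} _ = begin
    periodCount N
      ≡⟨ periodCount-halves N ⟩
    periodCount ⌈ N /2⌉ + count (isPeriodᵗ N ∘ suc ∘ dbl) ⌊ N /2⌋
      ≡⟨ cong₂ (λ a b → periodCount a + count (isPeriodᵗ N ∘ suc ∘ dbl) b)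
               (⌊suc-dbl/2⌋≡ (suc r)) (⌊dbl/2⌋≡ (suc r)) ⟩
    periodCount (suc r) + count (isPeriodᵗ N ∘ suc ∘ dbl) (suc r)
      ≡⟨ cong (_+_ (periodCount (suc r))) (count-odd-periods r ≤-refl) ⟩
    periodCount (suc r) + fromBool (isPeriodᵗ N (suc (dbl r)))
      ≡⟨ cong (λ b → periodCount (suc r) + fromBool b) (trans (isPeriodᵗ-overlap 1 (dbl r)) last) ⟩
    periodCount (suc r) + fromBool (tm r) ∎
    where
    open ≡-Reasoning
    N = dbl (suc r)
    last : isYes (false Bool.≟ tm (suc (dbl r))) ∧ true ≡ tm r
    last rewrite tm-suc-dbl r with tm r
    ... | false = refl
    ... | true  = refl

  periodCount-suc-dbl : ∀ {n} → 1 ≤ n →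
    periodCount (suc (dbl n)) ≡ periodCount (suc n) + fromBool (tm (pred n) ∧ tm n)
  periodCount-suc-dbl {suc r} _ = begin
    periodCount N
      ≡⟨ periodCount-halves N ⟩
    periodCount ⌈ N /2⌉ + count (isPeriodᵗ N ∘ suc ∘ dbl) ⌊ N /2⌋
      ≡⟨ cong₂ (λ a b → periodCount a + count (isPeriodᵗ N ∘ suc ∘ dbl) b)
               (cong suc (⌊dbl/2⌋≡ (suc r))) (⌊suc-dbl/2⌋≡ (suc r)) ⟩
    periodCount (suc (suc r)) + count (isPeriodᵗ N ∘ suc ∘ dbl) (suc r)
      ≡⟨ cong (_+_ (periodCount (suc (suc r)))) (count-odd-periods r (n≤1+n (dbl (suc r)))) ⟩
    periodCount (suc (suc r)) + fromBool (isPeriodᵗ N (suc (dbl r)))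
      ≡⟨ cong (λ b → periodCount (suc (suc r)) + fromBool b) (trans (isPeriodᵗ-overlap 2 (dbl r)) last) ⟩
    periodCount (suc (suc r)) + fromBool (tm r ∧ tm (suc r)) ∎
    where
    open ≡-Reasoning
    N = suc (dbl (suc r))
    last : isYes (false Bool.≟ tm (suc (dbl r))) ∧ (isYes (true Bool.≟ tm (dbl (suc r))) ∧ true)
         ≡ tm r ∧ tm (suc r)
    last rewrite tm-suc-dbl r | tm-dbl (suc r) with tm r | tm (suc r)
    ... | false | _     = refl
    ... | true  | false = refl
    ... | true  | true  = refl

  -- Growth of the period count

  weight : Bool → Bool → ℕ
  weight false _     = 1
  weight true  false = 2
  weight true  true  = 4

  2≤weight : ∀ b → 2 ≤ weight true b
  2≤weight false = ≤-refl
  2≤weight true  = s≤s (s≤s z≤n)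

  1≤weight : ∀ a b → 1 ≤ weight a b
  1≤weight false _ = ≤-refl
  1≤weight true  b = ≤-trans (s≤s z≤n) (2≤weight b)

  -- From m to 2m+1 or 2m+2 the right-hand side doubles; a new period (a factor 4 on the
  -- left) appears only when the weight, read off the last two letters, drops by at least 2.
  WeightedBound : ℕ → Set
  WeightedBound m = 4 ^ periodCount (suc m) * weight (tm m) (tm (pred m)) ≤ dbl m

  weightedBound-odd : ∀ m → WeightedBound m → WeightedBound (suc (dbl m))
  weightedBound-odd m wb rewrite periodCount-dbl {suc m} (s≤s z≤n) | tm-suc-dbl m | tm-dbl m with tm m
  ... | false = begin
    4 ^ (c + 0) * 2   ≡⟨ cong (λ e → 4 ^ e * 2) (+-identityʳ c) ⟩
    4 ^ c * 2         ≡⟨ *-dbl (4 ^ c) 1 ⟩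
    dbl (4 ^ c * 1)   ≤⟨ dbl-mono-≤ wb ⟩
    dbl (dbl m)       ≤⟨ m≤n+m (dbl (dbl m)) 2 ⟩
    2 + dbl (dbl m)   ∎
    where
    open ≤-Reasoning
    c = periodCount (suc m)
  ... | true = begin
    4 ^ (c + 1) * 1   ≡⟨ *-identityʳ (4 ^ (c + 1)) ⟩
    4 ^ (c + 1)       ≡⟨ ^-distribˡ-+-* 4 c 1 ⟩
    4 ^ c * 4         ≡⟨ *-dbl (4 ^ c) 2 ⟩
    dbl (4 ^ c * 2)   ≤⟨ dbl-mono-≤ (≤-trans (*-monoʳ-≤ (4 ^ c) (2≤weight (tm (pred m)))) wb) ⟩
    dbl (dbl m)       ≤⟨ m≤n+m (dbl (dbl m)) 2 ⟩
    2 + dbl (dbl m)   ∎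
    where
    open ≤-Reasoning
    c = periodCount (suc m)

  weightedBound-even : ∀ r → WeightedBound (suc r) → WeightedBound (dbl (suc r))
  weightedBound-even r wb
    rewrite periodCount-suc-dbl {suc r} (s≤s z≤n) | tm-dbl (suc r) | tm-suc-dbl r
    with tm (suc r) | tm r
  ... | false | b rewrite ∧-zeroʳ b = begin
    4 ^ (c + 0) * 1        ≡⟨ cong (λ e → 4 ^ e * 1) (+-identityʳ c) ⟩
    4 ^ c * 1              ≤⟨ wb ⟩
    dbl (suc r)            ≤⟨ n≤dbl (dbl (suc r)) ⟩
    dbl (dbl (suc r))      ∎
    where
    open ≤-Reasoning
    c = periodCount (suc (suc r))
  ... | true | true = begin
    4 ^ (c + 1) * 2        ≡⟨ cong (_* 2) (^-distribˡ-+-* 4 c 1) ⟩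
    4 ^ c * 4 * 2          ≡⟨ *-dbl (4 ^ c * 4) 1 ⟩
    dbl (4 ^ c * 4 * 1)    ≡⟨ cong dbl (*-identityʳ (4 ^ c * 4)) ⟩
    dbl (4 ^ c * 4)        ≤⟨ dbl-mono-≤ wb ⟩
    dbl (dbl (suc r))      ∎
    where
    open ≤-Reasoning
    c = periodCount (suc (suc r))
  ... | true | false = begin
    4 ^ (c + 0) * 4        ≡⟨ cong (λ e → 4 ^ e * 4) (+-identityʳ c) ⟩
    4 ^ c * 4              ≡⟨ *-dbl (4 ^ c) 2 ⟩
    dbl (4 ^ c * 2)        ≤⟨ dbl-mono-≤ wb ⟩
    dbl (dbl (suc r))      ∎
    where
    open ≤-Reasoning
    c = periodCount (suc (suc r))

  weightedBound : ∀ m → WeightedBound (suc m)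
  weightedBound = <-rec (WeightedBound ∘ suc) step
    where
    step : ∀ m → (∀ {k} → k < m → WeightedBound (suc k)) → WeightedBound (suc m)
    step m rec with evenOdd m
    ... | even zero    = s≤s (s≤s z≤n)
    ... | even (suc r) = weightedBound-odd (suc r) (rec (s≤s (m≤n⇒m≤1+n (n≤dbl r))))
    ... | odd r        = weightedBound-even r (rec (s≤s (n≤dbl r)))

  4^periodCount≤2n : ∀ {n} → 2 ≤ n → 4 ^ periodCount n ≤ dbl n
  4^periodCount≤2n {suc (suc k)} (s≤s (s≤s _)) = begin
    4 ^ c                                 ≡⟨ *-identityʳ (4 ^ c) ⟨
    4 ^ c * 1                             ≤⟨ *-monoʳ-≤ (4 ^ c) (1≤weight (tm (suc k)) (tm k)) ⟩
    4 ^ c * weight (tm (suc k)) (tm k)    ≤⟨ weightedBound k ⟩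
    dbl (suc k)                           ≤⟨ dbl-mono-≤ (n≤1+n (suc k)) ⟩
    dbl (suc (suc k))                     ∎
    where
    open ≤-Reasoning
    c = periodCount (suc (suc k))

  periodCount-suc-·2^ : ∀ {m} k → 1 ≤ m →
    periodCount (suc (m ·2^ suc k)) ≡ periodCount (suc (m ·2^ k)) + fromBool (tm (pred (m ·2^ k)) ∧ tm m)
  periodCount-suc-·2^ {m} k 1≤m = trans (periodCount-suc-dbl (≤-trans 1≤m (m≤m·2^k m k)))
    (cong (λ b → periodCount (suc (m ·2^ k)) + fromBool (tm (pred (m ·2^ k)) ∧ b)) (tm-·2^ m k))

  tm-pred-1·2^ : ∀ k → tm (pred (1 ·2^ k)) ≡ oddᵇ k
  tm-pred-1·2^ zero    = refl
  tm-pred-1·2^ (suc k) with 1 ·2^ k | m≤m·2^k 1 k | tm-pred-1·2^ k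
  ... | suc x | _ | t≡ = trans (tm-suc-dbl x) (trans (cong not t≡) (sym (oddᵇ-suc k)))

  periodCount-4^k+1 : ∀ k → periodCount (suc (1 ·2^ dbl k)) ≡ k
  periodCount-4^k+1 zero    = refl
  periodCount-4^k+1 (suc k) = begin
    periodCount (suc (1 ·2^ suc (suc (dbl k))))
      ≡⟨ step (suc (dbl k)) ⟩
    periodCount (suc (1 ·2^ suc (dbl k))) + fromBool (oddᵇ (suc (dbl k)))
      ≡⟨ cong₂ _+_ (step (dbl k)) (cong fromBool (oddᵇ-suc-dbl k)) ⟩
    periodCount (suc (1 ·2^ dbl k)) + fromBool (oddᵇ (dbl k)) + 1
      ≡⟨ cong (λ c → c + fromBool (oddᵇ (dbl k)) + 1) (periodCount-4^k+1 k) ⟩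
    k + fromBool (oddᵇ (dbl k)) + 1
      ≡⟨ cong (λ b → k + fromBool b + 1) (oddᵇ-dbl k) ⟩
    k + 0 + 1
      ≡⟨ trans (cong (_+ 1) (+-identityʳ k)) (+-comm k 1) ⟩
    suc k ∎
    where
    open ≡-Reasoning
    step : ∀ j → periodCount (suc (1 ·2^ suc j)) ≡ periodCount (suc (1 ·2^ j)) + fromBool (oddᵇ j)
    step j = trans (periodCount-suc-·2^ j ≤-refl)
      (cong (λ b → periodCount (suc (1 ·2^ j)) + fromBool b)
            (trans (cong (_∧ true) (tm-pred-1·2^ j)) (∧-identityʳ (oddᵇ j))))

  periodCount-3·2^k+1 : ∀ k → periodCount (suc (3 ·2^ k)) ≡ 1
  periodCount-3·2^k+1 zero    = refl
  periodCount-3·2^k+1 (suc k) = begin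
    periodCount (suc (3 ·2^ suc k))
      ≡⟨ periodCount-suc-·2^ k (s≤s z≤n) ⟩
    periodCount (suc (3 ·2^ k)) + fromBool (tm (pred (3 ·2^ k)) ∧ false)
      ≡⟨ cong₂ _+_ (periodCount-3·2^k+1 k) (cong fromBool (∧-zeroʳ (tm (pred (3 ·2^ k))))) ⟩
    1 ∎
    where open ≡-Reasoning

  -- The limits

  ^-distribʳ-* : ∀ m n k → (m * n) ^ k ≡ m ^ k * n ^ k
  ^-distribʳ-* m n zero    = refl
  ^-distribʳ-* m n (suc k) = trans (cong (m * n *_) (^-distribʳ-* m n k)) (*-interchange m n (m ^ k) (n ^ k))

  ^-cancelˡ-≤ : ∀ k .{{_ : NonZero k}} {m n} → m ^ k ≤ n ^ k → m ≤ n
  ^-cancelˡ-≤ k mᵏ≤nᵏ = ≮⇒≥ (λ n<m → <⇒≱ (^-monoˡ-< k n<m) mᵏ≤nᵏ)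

  -- Square both sides: (2^(md))² = (4^m)^d ≤ (2n)^d = 2^d n^d ≤ n^(d+1) ≤ (n^c)².
  2^[m*d]≤n^c : ∀ {m n c d} → 4 ^ m ≤ dbl n → 2 ^ d ≤ n → d < 2 * c → 2 ^ (m * d) ≤ n ^ c
  2^[m*d]≤n^c {m} {n} {c} {d} 4^m≤2n 2^d≤n d<2c = ^-cancelˡ-≤ 2 (begin
    (2 ^ (m * d)) ^ 2  ≡⟨ ^-*-assoc 2 (m * d) 2 ⟩
    2 ^ (m * d * 2)    ≡⟨ cong (2 ^_) (trans (*-comm (m * d) 2) (sym (*-assoc 2 m d))) ⟩
    2 ^ (2 * m * d)    ≡⟨ ^-*-assoc 2 (2 * m) d ⟨
    (2 ^ (2 * m)) ^ d  ≡⟨ cong (_^ d) (^-*-assoc 2 2 m) ⟨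
    (4 ^ m) ^ d        ≤⟨ ^-monoˡ-≤ d 4^m≤2n ⟩
    dbl n ^ d          ≡⟨ cong (_^ d) (dbl≡2* n) ⟩
    (2 * n) ^ d        ≡⟨ ^-distribʳ-* 2 n d ⟩
    2 ^ d * n ^ d      ≤⟨ *-monoˡ-≤ (n ^ d) 2^d≤n ⟩
    n ^ suc d          ≤⟨ ^-monoʳ-≤ n d<2c ⟩
    n ^ (2 * c)        ≡⟨ cong (n ^_) (*-comm 2 c) ⟩
    n ^ (c * 2)        ≡⟨ ^-*-assoc n c 2 ⟨
    (n ^ c) ^ 2        ∎)
    where
    open ≤-Reasoning
    instance
      _ : NonZero n
      _ = >-nonZero (≤-trans (m^n>0 2 d) 2^d≤n)

  [4^k+1]^c≤2^[k*d] : ∀ {k c d} → c ≤ k → 2 * c < d → suc (1 ·2^ dbl k) ^ c ≤ 2 ^ (k * d)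
  [4^k+1]^c≤2^[k*d] {k} {c} {d} c≤k 2c<d = begin
    suc (1 ·2^ dbl k) ^ c    ≤⟨ ^-monoˡ-≤ c (1+n≤dbl (≤-trans (s≤s z≤n) (m≤m·2^k 1 (dbl k)))) ⟩
    (1 ·2^ suc (dbl k)) ^ c  ≡⟨ cong (_^ c) (1·2^≡2^ (suc (dbl k))) ⟩
    (2 ^ suc (dbl k)) ^ c    ≡⟨ ^-*-assoc 2 (suc (dbl k)) c ⟩
    2 ^ (suc (dbl k) * c)    ≤⟨ ^-monoʳ-≤ 2 exponents ⟩
    2 ^ (k * d)              ∎
    where
    open ≤-Reasoning
    1+n≤dbl : ∀ {n} → 1 ≤ n → suc n ≤ dbl n
    1+n≤dbl {suc n} _ = s≤s (s≤s (n≤dbl n))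
    exponents : suc (dbl k) * c ≤ k * d
    exponents = begin
      c + dbl k * c      ≡⟨ cong (λ e → c + e * c) (trans (dbl≡2* k) (*-comm 2 k)) ⟩
      c + k * 2 * c      ≡⟨ cong (_+_ c) (*-assoc k 2 c) ⟩
      c + k * (2 * c)    ≤⟨ +-monoˡ-≤ (k * (2 * c)) c≤k ⟩
      k + k * (2 * c)    ≡⟨ *-suc k (2 * c) ⟨
      k * suc (2 * c)    ≤⟨ *-monoʳ-≤ k 2c<d ⟩
      k * d              ∎

  2^d≤[3·2^k+1]^c : ∀ {k c d} → d ≤ k → 1 ≤ c → 2 ^ d ≤ suc (3 ·2^ k) ^ c
  2^d≤[3·2^k+1]^c {k} {c} {d} d≤k 1≤c = begin
    2 ^ d                ≤⟨ ^-monoʳ-≤ 2 d≤k ⟩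
    2 ^ k                ≡⟨ 1·2^≡2^ k ⟨
    1 ·2^ k              ≤⟨ ·2^-monoˡ-≤ k (s≤s z≤n) ⟩
    3 ·2^ k              ≤⟨ n≤1+n (3 ·2^ k) ⟩
    suc (3 ·2^ k)        ≡⟨ ^-identityʳ (suc (3 ·2^ k)) ⟨
    suc (3 ·2^ k) ^ 1    ≤⟨ ^-monoʳ-≤ (suc (3 ·2^ k)) 1≤c ⟩
    suc (3 ·2^ k) ^ c    ∎
    where open ≤-Reasoning

  ↧<2∣↥∣ : ∀ q → + 1 / 2 ℚ.< q → ↧ₙ q < 2 * ∣ ↥ q ∣
  ↧<2∣↥∣ (mkℚ (+ c) d _) (ℚ.*<* d+1<2c) = subst₂ _<_ (+-identityʳ (suc d)) (*-comm c 2)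
    (ℤ.drop‿+<+ (subst₂ ℤ._<_ (sym (ℤ.pos-* 1 (suc d))) (sym (ℤ.pos-* c 2)) d+1<2c))
  ↧<2∣↥∣ (mkℚ -[1+ c ] d _) (ℚ.*<* ())

  2∣↥∣<↧ : ∀ q → 0ℚ ℚ.≤ q → q ℚ.< + 1 / 2 → 2 * ∣ ↥ q ∣ < ↧ₙ q
  2∣↥∣<↧ (mkℚ (+ c) d _) _ (ℚ.*<* 2c<d+1) = subst₂ _<_ (*-comm c 2) (+-identityʳ (suc d))
    (ℤ.drop‿+<+ (subst₂ ℤ._<_ (sym (ℤ.pos-* c 2)) (sym (ℤ.pos-* 1 (suc d))) 2c<d+1))
  2∣↥∣<↧ (mkℚ -[1+ c ] d _) (ℚ.*≤* ()) _

  1≤∣↥∣ : ∀ q → 0ℚ ℚ.< q → 1 ≤ ∣ ↥ q ∣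
  1≤∣↥∣ (mkℚ (+ zero)  d _) (ℚ.*<* (ℤ.+<+ ()))
  1≤∣↥∣ (mkℚ (+ suc c) d _) _ = s≤s z≤n
  1≤∣↥∣ (mkℚ -[1+ c ]  d _) (ℚ.*<* ())

  M≤/ln2-Y : ∀ {n} c → 5 ≤ n → 2^≤^ (periodCount n) n (c ℚ.* 5/3) → M≤/ln2 (Y n) c
  M≤/ln2-Y {n} c 5≤n bound =
    subst₂ (λ m q → 2^≤^ m (length (Y n)) (c ℚ.* q)) (sym (nnp-Y n)) (sym (ice-Y 5≤n))
      (subst (λ L → 2^≤^ (periodCount n) L (c ℚ.* 5/3)) (sym (length-Y n)) bound)

  M≥/ln2-Y : ∀ {n} c → 5 ≤ n → ^≤2^ (periodCount n) n (c ℚ.* 5/3) → M≥/ln2 (Y n) c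
  M≥/ln2-Y {n} c 5≤n bound =
    subst₂ (λ m q → ^≤2^ m (length (Y n)) (c ℚ.* q)) (sym (nnp-Y n)) (sym (ice-Y 5≤n))
      (subst (λ L → ^≤2^ (periodCount n) L (c ℚ.* 5/3)) (sym (length-Y n)) bound)

  limsup-M≤ : (ε : ℚ) → 0ℚ ℚ.< ε →
              ∃[ N ] ((n : ℕ) → N ≤ n → 2 ≤ n → M≤/ln2 (Y n) ((+ 3 / 10) ℚ.+ ε))
  limsup-M≤ ε ε>0 = 5 + 2 ^ d , λ n N≤n 2≤n →
    M≤/ln2-Y ((+ 3 / 10) ℚ.+ ε) (≤-trans (m≤m+n 5 (2 ^ d)) N≤n)
      (2^[m*d]≤n^c {m = periodCount n} {c = ∣ ↥ q ∣}
        (4^periodCount≤2n 2≤n) (≤-trans (m≤n+m (2 ^ d) 5) N≤n) (↧<2∣↥∣ q ½<q))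
    where
    q = ((+ 3 / 10) ℚ.+ ε) ℚ.* 5/3
    d = ↧ₙ q
    -- (+ 3 / 10) ℚ.* 5/3 reduces to + 1 / 2.
    ½<q : + 1 / 2 ℚ.< q
    ½<q = ℚ.*-monoˡ-<-pos 5/3
      (subst (ℚ._< (+ 3 / 10) ℚ.+ ε) (ℚ.+-identityʳ (+ 3 / 10)) (ℚ.+-monoʳ-< (+ 3 / 10) ε>0))

  limsup-M≥ : (ε : ℚ) → 0ℚ ℚ.< ε → ε ℚ.< + 3 / 10 → (N : ℕ) →
              ∃[ n ] (N ≤ n × 2 ≤ n × M≥/ln2 (Y n) ((+ 3 / 10) ℚ.- ε))
  limsup-M≥ ε ε>0 ε<3/10 N = n , N≤n , ≤-trans (s≤s (s≤s z≤n)) 5≤n ,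
    M≥/ln2-Y ((+ 3 / 10) ℚ.- ε) 5≤n
      (subst (λ m → n ^ c ≤ 2 ^ (m * d)) (sym (periodCount-4^k+1 k))
        ([4^k+1]^c≤2^[k*d] (≤-trans (m≤n+m c N) (n≤1+n (N + c))) (2∣↥∣<↧ q 0≤q q<½)))
    where
    q = ((+ 3 / 10) ℚ.- ε) ℚ.* 5/3
    c = ∣ ↥ q ∣
    d = ↧ₙ q
    k = suc (N + c)
    n = suc (1 ·2^ dbl k)
    N≤n : N ≤ n
    N≤n = begin
      N             ≤⟨ m≤m+n N c ⟩
      N + c         <⟨ n<1+n (N + c) ⟩
      k             ≤⟨ n≤dbl k ⟩
      dbl k         <⟨ n<1·2^n (dbl k) ⟩
      1 ·2^ dbl k   <⟨ n<1+n (1 ·2^ dbl k) ⟩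
      n             ∎
      where open ≤-Reasoning
    5≤n : 5 ≤ n
    5≤n = s≤s (dbl-mono-≤ (dbl-mono-≤ (m≤m·2^k 1 (dbl (N + c)))))
    0≤q : 0ℚ ℚ.≤ q
    0≤q = subst (ℚ._≤ q) (ℚ.*-zeroˡ 5/3) (ℚ.*-monoʳ-≤-nonNeg 5/3 (ℚ.<⇒≤
      (subst (ℚ._< (+ 3 / 10) ℚ.- ε) (ℚ.+-inverseʳ ε) (ℚ.+-monoˡ-< (ℚ.- ε) ε<3/10))))
    q<½ : q ℚ.< + 1 / 2
    q<½ = ℚ.*-monoˡ-<-pos 5/3
      (subst ((+ 3 / 10) ℚ.- ε ℚ.<_) (ℚ.+-identityʳ (+ 3 / 10))
             (ℚ.+-monoʳ-< (+ 3 / 10) (ℚ.neg-antimono-< ε>0)))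

  liminf-M≤ : (ε : ℚ) → 0ℚ ℚ.< ε → (N : ℕ) → ∃[ n ] (N ≤ n × 2 ≤ n × M≤/ln2 (Y n) ε)
  liminf-M≤ ε ε>0 N = n , N≤n , ≤-trans (s≤s (s≤s z≤n)) 5≤n ,
    M≤/ln2-Y ε 5≤n
      (subst (λ m → 2 ^ (m * d) ≤ n ^ c) (sym (periodCount-3·2^k+1 k))
        (subst (λ e → 2 ^ e ≤ n ^ c) (sym (*-identityˡ d))
          (2^d≤[3·2^k+1]^c (≤-trans (m≤n+m d N) (n≤1+n (N + d))) (1≤∣↥∣ q 0<q))))
    where
    q = ε ℚ.* 5/3
    c = ∣ ↥ q ∣
    d = ↧ₙ q
    k = suc (N + d)
    n = suc (3 ·2^ k)
    N≤n : N ≤ n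
    N≤n = begin
      N         ≤⟨ m≤m+n N d ⟩
      N + d     <⟨ n<1+n (N + d) ⟩
      k         <⟨ n<1·2^n k ⟩
      1 ·2^ k   ≤⟨ ·2^-monoˡ-≤ k (s≤s z≤n) ⟩
      3 ·2^ k   <⟨ n<1+n (3 ·2^ k) ⟩
      n         ∎
      where open ≤-Reasoning
    5≤n : 5 ≤ n
    5≤n = s≤s (dbl-mono-≤ {2} (≤-trans (s≤s (s≤s z≤n)) (m≤m·2^k 3 (N + d))))
    0<q : 0ℚ ℚ.< q
    0<q = subst (ℚ._< q) (ℚ.*-zeroˡ 5/3) (ℚ.*-monoˡ-<-pos 5/3 ε>0)

open ThueMorsePrefixes using (limsup-M≤; limsup-M≥; liminf-M≤)

open import Data.Nat using (ℕ; _≤_)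
open import Data.Rational using (ℚ; _+_; _-_; _/_; 0ℚ)
open import Data.Product using (_×_; _,_; ∃-syntax)
open import Data.Integer using (+_)

theorem15 :
    -- P(t) ≤ 3/(10 ln 2): for every ε > 0, eventually M(Y_n) ≤ (3/10 + ε)/ln 2
    ((ε : ℚ) → Data.Rational._<_ 0ℚ ε →
      ∃[ N ] ((n : ℕ) → N ≤ n → 2 ≤ n → M≤/ln2 (Y n) ((+ 3 / 10) + ε)))
    -- P(t) ≥ 3/(10 ln 2): for 0 < ε < 3/10, infinitely often M(Y_n) ≥ (3/10 - ε)/ln 2
  × ((ε : ℚ) → Data.Rational._<_ 0ℚ ε → Data.Rational._<_ ε (+ 3 / 10) → (N : ℕ) →
      ∃[ n ] (N ≤ n × 2 ≤ n × M≥/ln2 (Y n) ((+ 3 / 10) - ε)))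
    -- p(t) = 0 (M ≥ 0 always): for every ε > 0, infinitely often M(Y_n) ≤ ε/ln 2
  × ((ε : ℚ) → Data.Rational._<_ 0ℚ ε → (N : ℕ) →
      ∃[ n ] (N ≤ n × 2 ≤ n × M≤/ln2 (Y n) ε))
theorem15 = limsup-M≤ , limsup-M≥ , liminf-M≤
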